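{- Let $m,n,\lambda$ be positive integers. If a $\mathrm{GDD}(m,n;3,\lambda)$ exists, then (NC1) $3\mid\lambda mn$; (NC2) $2\mid n-1+\lambda m$ and $2\mid m-1+\lambda n$; and (NC3) $\frac{\lambda}{3}\leq\frac{m-1}{n}+\frac{n-1}{m}$.
   Context: A group divisible design $\mathrm{GDD}(m,n;\lambda_1,\lambda_2)$ is a pair $(V,\mathcal{B})$ where $V=M\cup N$ with $M,N$ disjoint, $|M|=m$, $|N|=n$ (the two groups), and $\mathcal{B}$ is a collection (repetitions allowed) of 3-element subsets (blocks) of $V$ such that each pair of distinct symbols in the same group lies in exactly $\lambda_1$ blocks and each pair of symbols from different groups lies in exactly $\lambda_2$ blocks. -}

module Defs where

open import Data.Nat using (ℕ)
open import Data.Fin using (Fin)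
import Data.Fin.Properties as FinP
open import Data.Sum using (_⊎_; inj₁; inj₂)
import Data.Sum.Properties as SumP
open import Data.Product using (_×_; Σ)
open import Data.List using (List; length; filter)
open import Relation.Binary.PropositionalEquality using (_≡_; _≢_)
open import Relation.Nullary using (Dec; ¬_)
open import Data.Unit using (⊤)
open import Data.Empty using (⊥)
open import Relation.Nullary.Decidable using (_⊎-dec_; _×-dec_)

-- Symbol set V = M ∪ N with M = Fin m (first group), N = Fin n (second group).
Point : ℕ → ℕ → Set
Point m n = Fin m ⊎ Fin n

_≟P_ : ∀ {m n} (x y : Point m n) → Dec (x ≡ y)
_≟P_ = SumP.≡-dec FinP._≟_ FinP._≟_

record Block (m n : ℕ) : Set where
  constructor block
  field
    p₁ p₂ p₃ : Point m n
    d₁₂ : p₁ ≢ p₂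
    d₁₃ : p₁ ≢ p₃
    d₂₃ : p₂ ≢ p₃
open Block public

_∈B_ : ∀ {m n} → Point m n → Block m n → Set
x ∈B B = x ≡ p₁ B ⊎ x ≡ p₂ B ⊎ x ≡ p₃ B

_∈B?_ : ∀ {m n} (x : Point m n) (B : Block m n) → Dec (x ∈B B)
x ∈B? B = (x ≟P p₁ B) ⊎-dec ((x ≟P p₂ B) ⊎-dec (x ≟P p₃ B))

count : ∀ {m n} → List (Block m n) → Point m n → Point m n → ℕ
count ℬ x y = length (filter (λ B → (x ∈B? B) ×-dec (y ∈B? B)) ℬ)

SameGroup : ∀ {m n} → Point m n → Point m n → Set
SameGroup (inj₁ _) (inj₁ _) = ⊤
SameGroup (inj₂ _) (inj₂ _) = ⊤
SameGroup _ _ = ⊥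

-- (V, ℬ) is a GDD(m,n;λ₁,λ₂): the collection ℬ (a list, repetitions allowed)
record IsGDD (m n λ₁ λ₂ : ℕ) (ℬ : List (Block m n)) : Set where
  field
    within  : ∀ (x y : Point m n) → x ≢ y → SameGroup x y → count ℬ x y ≡ λ₁
    between : ∀ (x y : Point m n) → ¬ SameGroup x y → count ℬ x y ≡ λ₂

GDD : ℕ → ℕ → ℕ → ℕ → Set
GDD m n λ₁ λ₂ = Σ (List (Block m n)) (IsGDD m n λ₁ λ₂)

module Submission where

-- Let r x be the number of blocks through the symbol x.  Counting the pairs (x, y) covered by
-- blocks through x in two ways gives 3 r x = r x + 3 (m - 1) + λ n for x in M, so
-- 2 r x = 3 (m - 1) + λ n, which is (NC2).  Summing this over all symbols and using that the
-- blocks have 3 |ℬ| incidences gives 3 m (m - 1) + 3 n (n - 1) + 2 λ m n = 6 |ℬ|, whence (NC1).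
-- A block meeting M in a and N in b = 3 - a symbols covers a b ≤ 2 cross pairs, so
-- λ m n ≤ 2 |ℬ|; together with the identity this is (NC3).

open import Defs
open import Data.Nat using (ℕ; NonZero; _+_; _*_; _∸_)
open import Data.Nat.Divisibility using (_∣_)
open import Data.Integer using (+_)
open import Data.Rational using (_≤_; _/_) renaming (_+_ to _+ℚ_)
open import Data.Product using (_×_)

open import Data.Bool using (if_then_else_)
open import Data.Empty using (⊥-elim)
open import Data.Fin using (Fin; zero; suc; punchIn)
open import Data.Fin.Properties using (punchInᵢ≢i) renaming (_≟_ to _≟ᶠ_)
import Data.Integer as ℤ
import Data.Integer.Properties as ℤ
open import Data.List using (List; []; _∷_; length; filter; lookup)
open import Data.Nat using (zero; suc; z≤n) renaming (_≤_ to _≤ℕ_)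
open import Data.Nat.Divisibility using (∣m+n∣m⇒∣n; m∣m*n)
open import Data.Nat.Properties
open import Data.Nat.Tactic.RingSolver using (solve-∀)
open import Data.Product using (_,_)
open import Data.Rational using (toℚᵘ)
open import Data.Rational.Properties using (toℚᵘ-cancel-≤; toℚᵘ-homo-+; toℚᵘ-fromℚᵘ)
open import Data.Rational.Unnormalised as ℚᵘ using (mkℚᵘ; *≤*)
import Data.Rational.Unnormalised.Properties as ℚᵘ
open import Data.Sum using (inj₁; inj₂)
open import Data.Sum.Properties using (inj₁-injective; inj₂-injective)
open import Data.Unit using (tt)
open import Function using (_∘_)
open import Relation.Binary.PropositionalEquality
open import Relation.Nullary using (Dec; yes; no; does; ¬_)
open import Relation.Nullary.Decidable using (_×-dec_; _⊎-dec_)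
open import Relation.Unary using (Decidable)

open import Algebra.Properties.CommutativeSemigroup +-commutativeSemigroup
  using () renaming (interchange to +-interchange)
open import Algebra.Properties.Semiring.Sum +-*-semiring
  using ( sum; sum-syntax; sum-cong-≗; sum-remove; sum-replicate-zero
        ; ∑-distrib-+; ∑-comm; *-distribˡ-sum; *-distribʳ-sum )

-- Defined through does, so that it computes through map′: ⟦ inj₁ i ≟P inj₁ j ⟧ is ⟦ i ≟ᶠ j ⟧.
⟦_⟧ : {A : Set} → Dec A → ℕ
⟦ a? ⟧ = if does a? then 1 else 0

⟦×-dec⟧ : {A B : Set} (a? : Dec A) (b? : Dec B) → ⟦ a? ×-dec b? ⟧ ≡ ⟦ a? ⟧ * ⟦ b? ⟧
⟦×-dec⟧ (yes _) (yes _) = refl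
⟦×-dec⟧ (yes _) (no _)  = refl
⟦×-dec⟧ (no _)  _       = refl

⟦⊎-dec⟧ : {A B : Set} (a? : Dec A) (b? : Dec B) → ¬ (A × B) →
          ⟦ a? ⊎-dec b? ⟧ ≡ ⟦ a? ⟧ + ⟦ b? ⟧
⟦⊎-dec⟧ (yes a) (yes b) ¬a×b = ⊥-elim (¬a×b (a , b))
⟦⊎-dec⟧ (yes _) (no _)  _    = refl
⟦⊎-dec⟧ (no _)  (yes _) _    = refl
⟦⊎-dec⟧ (no _)  (no _)  _    = refl

⟦⟧-idem : {A : Set} (a? : Dec A) → ⟦ a? ⟧ * ⟦ a? ⟧ ≡ ⟦ a? ⟧
⟦⟧-idem (yes _) = refl
⟦⟧-idem (no _)  = refl

length-filter-∷ : {A : Set} {P : A → Set} (P? : Decidable P) (x : A) (xs : List A) →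
                  length (filter P? (x ∷ xs)) ≡ ⟦ P? x ⟧ + length (filter P? xs)
length-filter-∷ P? x xs with P? x
... | yes _ = refl
... | no _  = refl

∑-const : ∀ k c → ∑[ i < k ] c ≡ k * c
∑-const zero    c = refl
∑-const (suc k) c = cong (_+_ c) (∑-const k c)

∑-mono-≤ : ∀ {k} {f g : Fin k → ℕ} → (∀ i → f i ≤ℕ g i) → sum f ≤ℕ sum g
∑-mono-≤ {zero}  _   = ≤-refl
∑-mono-≤ {suc k} f≤g = +-mono-≤ (f≤g zero) (∑-mono-≤ (f≤g ∘ suc))

∑-δ : ∀ {k} (j : Fin k) → ∑[ i < k ] ⟦ i ≟ᶠ j ⟧ ≡ 1
∑-δ {suc k} zero    = cong suc (sum-replicate-zero k)
∑-δ         (suc j) = ∑-δ j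

∑-except : ∀ {k} (f : Fin (suc k) → ℕ) (i : Fin (suc k)) {c} →
           (∀ j → j ≢ i → f j ≡ c) → sum f ≡ f i + k * c
∑-except {k} f i {c} f≡c = trans (sum-remove {i = i} f) (cong (_+_ (f i)) (begin
  ∑[ j < k ] f (punchIn i j)  ≡⟨ sum-cong-≗ (λ j → f≡c (punchIn i j) (punchInᵢ≢i i j)) ⟩
  ∑[ j < k ] c                ≡⟨ ∑-const k c ⟩
  k * c                       ∎))
  where open ≡-Reasoning

module _ {m n : ℕ} where

  ∑ᴾ : (Point m n → ℕ) → ℕ
  ∑ᴾ f = ∑[ i < m ] f (inj₁ i) + ∑[ j < n ] f (inj₂ j)

  ∑ᴾ-cong : {f g : Point m n → ℕ} → (∀ x → f x ≡ g x) → ∑ᴾ f ≡ ∑ᴾ g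
  ∑ᴾ-cong f≡g = cong₂ _+_ (sum-cong-≗ (f≡g ∘ inj₁)) (sum-cong-≗ (f≡g ∘ inj₂))

  ∑ᴾ-distrib-+ : (f g : Point m n → ℕ) → ∑ᴾ (λ x → f x + g x) ≡ ∑ᴾ f + ∑ᴾ g
  ∑ᴾ-distrib-+ f g = trans
    (cong₂ _+_ (∑-distrib-+ (f ∘ inj₁) (g ∘ inj₁)) (∑-distrib-+ (f ∘ inj₂) (g ∘ inj₂)))
    (+-interchange (sum (f ∘ inj₁)) (sum (g ∘ inj₁)) (sum (f ∘ inj₂)) (sum (g ∘ inj₂)))

  ∑ᴾ-∑-comm : ∀ {k} (f : Fin k → Point m n → ℕ) →
              ∑ᴾ (λ x → ∑[ t < k ] f t x) ≡ ∑[ t < k ] ∑ᴾ (f t)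
  ∑ᴾ-∑-comm f = trans
    (cong₂ _+_ (∑-comm (λ i t → f t (inj₁ i))) (∑-comm (λ j t → f t (inj₂ j))))
    (sym (∑-distrib-+ (λ t → sum (f t ∘ inj₁)) (λ t → sum (f t ∘ inj₂))))

  ∑ᴾ-δ : ∀ p → ∑ᴾ (λ x → ⟦ x ≟P p ⟧) ≡ 1
  ∑ᴾ-δ (inj₁ k) = cong₂ _+_ (∑-δ k) (sum-replicate-zero n)
  ∑ᴾ-δ (inj₂ k) = cong₂ _+_ (sum-replicate-zero m) (∑-δ k)

  inc : Block m n → Point m n → ℕ
  inc B x = ⟦ x ∈B? B ⟧

  inc-split : ∀ B x → inc B x ≡ ⟦ x ≟P p₁ B ⟧ + (⟦ x ≟P p₂ B ⟧ + ⟦ x ≟P p₃ B ⟧)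
  inc-split B x = trans
    (⟦⊎-dec⟧ (x ≟P p₁ B) ((x ≟P p₂ B) ⊎-dec (x ≟P p₃ B))
      λ { (refl , inj₁ x≡p₂) → d₁₂ B x≡p₂ ; (refl , inj₂ x≡p₃) → d₁₃ B x≡p₃ })
    (cong (_+_ ⟦ x ≟P p₁ B ⟧)
      (⟦⊎-dec⟧ (x ≟P p₂ B) (x ≟P p₃ B) λ { (refl , x≡p₃) → d₂₃ B x≡p₃ }))

  block-size : ∀ B → ∑ᴾ (inc B) ≡ 3
  block-size B = begin
    ∑ᴾ (inc B)
      ≡⟨ ∑ᴾ-cong (inc-split B) ⟩
    ∑ᴾ (λ x → δ₁ x + (δ₂ x + δ₃ x))
      ≡⟨ ∑ᴾ-distrib-+ δ₁ (λ x → δ₂ x + δ₃ x) ⟩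
    ∑ᴾ δ₁ + ∑ᴾ (λ x → δ₂ x + δ₃ x)
      ≡⟨ cong (_+_ (∑ᴾ δ₁)) (∑ᴾ-distrib-+ δ₂ δ₃) ⟩
    ∑ᴾ δ₁ + (∑ᴾ δ₂ + ∑ᴾ δ₃)
      ≡⟨ cong₂ _+_ (∑ᴾ-δ (p₁ B)) (cong₂ _+_ (∑ᴾ-δ (p₂ B)) (∑ᴾ-δ (p₃ B))) ⟩
    3 ∎
    where
    open ≡-Reasoning
    δ₁ δ₂ δ₃ : Point m n → ℕ
    δ₁ x = ⟦ x ≟P p₁ B ⟧
    δ₂ x = ⟦ x ≟P p₂ B ⟧
    δ₃ x = ⟦ x ≟P p₃ B ⟧

  count-≡-∑ : ∀ ℬ x y →
              count ℬ x y ≡ ∑[ t < length ℬ ] (inc (lookup ℬ t) x * inc (lookup ℬ t) y)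
  count-≡-∑ []      x y = refl
  count-≡-∑ (B ∷ ℬ) x y = trans
    (length-filter-∷ (λ B → (x ∈B? B) ×-dec (y ∈B? B)) B ℬ)
    (cong₂ _+_ (⟦×-dec⟧ (x ∈B? B) (y ∈B? B)) (count-≡-∑ ℬ x y))

  module _ (ℬ : List (Block m n)) where

    count-diagonal : ∀ x → count ℬ x x ≡ ∑[ t < length ℬ ] inc (lookup ℬ t) x
    count-diagonal x =
      trans (count-≡-∑ ℬ x x) (sum-cong-≗ (λ t → ⟦⟧-idem (x ∈B? lookup ℬ t)))

    ∑-count : ∀ x {k} (g : Fin k → Point m n) →
      ∑[ j < k ] count ℬ x (g j)
        ≡ ∑[ t < length ℬ ] (inc (lookup ℬ t) x * ∑[ j < k ] inc (lookup ℬ t) (g j))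
    ∑-count x {k} g = begin
      ∑[ j < k ] count ℬ x (g j)
        ≡⟨ sum-cong-≗ (λ j → count-≡-∑ ℬ x (g j)) ⟩
      ∑[ j < k ] ∑[ t < length ℬ ] (r t * inc (lookup ℬ t) (g j))
        ≡⟨ ∑-comm (λ j t → r t * inc (lookup ℬ t) (g j)) ⟩
      ∑[ t < length ℬ ] ∑[ j < k ] (r t * inc (lookup ℬ t) (g j))
        ≡⟨ sum-cong-≗ (λ t → sym (*-distribˡ-sum (r t) (inc (lookup ℬ t) ∘ g))) ⟩
      ∑[ t < length ℬ ] (r t * ∑[ j < k ] inc (lookup ℬ t) (g j)) ∎
      where
      open ≡-Reasoning
      r : Fin (length ℬ) → ℕ
      r t = inc (lookup ℬ t) x

    ∑∑-count : ∀ {k l} (f : Fin k → Point m n) (g : Fin l → Point m n) →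
      ∑[ i < k ] ∑[ j < l ] count ℬ (f i) (g j)
        ≡ ∑[ t < length ℬ ] (∑[ i < k ] inc (lookup ℬ t) (f i)
                             * ∑[ j < l ] inc (lookup ℬ t) (g j))
    ∑∑-count {k} {l} f g = begin
      ∑[ i < k ] ∑[ j < l ] count ℬ (f i) (g j)
        ≡⟨ sum-cong-≗ (λ i → ∑-count (f i) g) ⟩
      ∑[ i < k ] ∑[ t < length ℬ ] (inc (lookup ℬ t) (f i) * G t)
        ≡⟨ ∑-comm (λ i t → inc (lookup ℬ t) (f i) * G t) ⟩
      ∑[ t < length ℬ ] ∑[ i < k ] (inc (lookup ℬ t) (f i) * G t)
        ≡⟨ sum-cong-≗ (λ t → sym (*-distribʳ-sum (G t) (inc (lookup ℬ t) ∘ f))) ⟩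
      ∑[ t < length ℬ ] (∑[ i < k ] inc (lookup ℬ t) (f i) * G t) ∎
      where
      open ≡-Reasoning
      G : Fin (length ℬ) → ℕ
      G t = ∑[ j < l ] inc (lookup ℬ t) (g j)

    ∑ᴾ-count : ∀ x → ∑ᴾ (count ℬ x) ≡ 3 * count ℬ x x
    ∑ᴾ-count x = begin
      ∑ᴾ (count ℬ x)
        ≡⟨ cong₂ _+_ (∑-count x inj₁) (∑-count x inj₂) ⟩
      ∑[ t < length ℬ ] (r t * a t) + ∑[ t < length ℬ ] (r t * b t)
        ≡⟨ ∑-distrib-+ (λ t → r t * a t) (λ t → r t * b t) ⟨
      ∑[ t < length ℬ ] (r t * a t + r t * b t)
        ≡⟨ sum-cong-≗ (λ t → *-distribˡ-+ (r t) (a t) (b t)) ⟨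
      ∑[ t < length ℬ ] (r t * (a t + b t))
        ≡⟨ sum-cong-≗ (λ t → cong (_*_ (r t)) (block-size (lookup ℬ t))) ⟩
      ∑[ t < length ℬ ] (r t * 3)
        ≡⟨ *-distribʳ-sum 3 r ⟨
      sum r * 3
        ≡⟨ cong (_* 3) (count-diagonal x) ⟨
      count ℬ x x * 3
        ≡⟨ *-comm (count ℬ x x) 3 ⟩
      3 * count ℬ x x ∎
      where
      open ≡-Reasoning
      r a b : Fin (length ℬ) → ℕ
      r t = inc (lookup ℬ t) x
      a t = ∑[ i < m ] inc (lookup ℬ t) (inj₁ i)
      b t = ∑[ j < n ] inc (lookup ℬ t) (inj₂ j)

    ∑ᴾ-count-diagonal : ∑ᴾ (λ x → count ℬ x x) ≡ 3 * length ℬ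
    ∑ᴾ-count-diagonal = begin
      ∑ᴾ (λ x → count ℬ x x)                           ≡⟨ ∑ᴾ-cong count-diagonal ⟩
      ∑ᴾ (λ x → ∑[ t < length ℬ ] inc (lookup ℬ t) x)  ≡⟨ ∑ᴾ-∑-comm (inc ∘ lookup ℬ) ⟩
      ∑[ t < length ℬ ] ∑ᴾ (inc (lookup ℬ t))          ≡⟨ sum-cong-≗ (block-size ∘ lookup ℬ) ⟩
      ∑[ t < length ℬ ] 3                              ≡⟨ ∑-const (length ℬ) 3 ⟩
      length ℬ * 3                                     ≡⟨ *-comm (length ℬ) 3 ⟩
      3 * length ℬ                                     ∎
      where open ≡-Reasoning

m+n≡3⇒m*n≤2 : ∀ {a b} → a + b ≡ 3 → a * b ≤ℕ 2
m+n≡3⇒m*n≤2 {0} refl = z≤n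
m+n≡3⇒m*n≤2 {1} refl = ≤-refl
m+n≡3⇒m*n≤2 {2} refl = ≤-refl
m+n≡3⇒m*n≤2 {3} refl = z≤n

r+w+b≡3*r⇒2*r≡w+b : ∀ r w b → r + w + b ≡ 3 * r → 2 * r ≡ w + b
r+w+b≡3*r⇒2*r≡w+b r w b row =
  +-cancelˡ-≡ r (2 * r) (w + b) (trans (sym row) (+-assoc r w b))

module _ {m n λ' : ℕ} {ℬ : List (Block (suc m) (suc n))}
         (gdd : IsGDD (suc m) (suc n) 3 λ' ℬ) where

  open IsGDD gdd

  ∑-count-across : ∀ x {k} (g : Fin k → Point (suc m) (suc n)) → (∀ j → ¬ SameGroup x (g j)) →
                   ∑[ j < k ] count ℬ x (g j) ≡ k * λ'
  ∑-count-across x {k} g apart =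
    trans (sum-cong-≗ (λ j → between x (g j) (apart j))) (∑-const k λ')

  replication₁ : ∀ i → 2 * count ℬ (inj₁ i) (inj₁ i) ≡ m * 3 + λ' * suc n
  replication₁ i = r+w+b≡3*r⇒2*r≡w+b (count ℬ x x) (m * 3) (λ' * suc n) (begin
    count ℬ x x + m * 3 + λ' * suc n  ≡⟨ cong₂ _+_ within-row between-row ⟨
    ∑ᴾ (count ℬ x)                    ≡⟨ ∑ᴾ-count ℬ x ⟩
    3 * count ℬ x x                   ∎)
    where
    open ≡-Reasoning
    x : Point (suc m) (suc n)
    x = inj₁ i
    within-row : ∑[ j < suc m ] count ℬ x (inj₁ j) ≡ count ℬ x x + m * 3
    within-row = ∑-except (count ℬ x ∘ inj₁) i
      (λ j j≢i → within x (inj₁ j) (j≢i ∘ sym ∘ inj₁-injective) tt)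
    between-row : ∑[ j < suc n ] count ℬ x (inj₂ j) ≡ λ' * suc n
    between-row = trans (∑-count-across x inj₂ (λ _ ())) (*-comm (suc n) λ')

  replication₂ : ∀ j → 2 * count ℬ (inj₂ j) (inj₂ j) ≡ n * 3 + λ' * suc m
  replication₂ j = r+w+b≡3*r⇒2*r≡w+b (count ℬ x x) (n * 3) (λ' * suc m) (begin
    count ℬ x x + n * 3 + λ' * suc m    ≡⟨ +-comm (count ℬ x x + n * 3) (λ' * suc m) ⟩
    λ' * suc m + (count ℬ x x + n * 3)  ≡⟨ cong₂ _+_ between-row within-row ⟨
    ∑ᴾ (count ℬ x)                      ≡⟨ ∑ᴾ-count ℬ x ⟩
    3 * count ℬ x x                     ∎)
    where
    open ≡-Reasoning
    x : Point (suc m) (suc n)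
    x = inj₂ j
    within-row : ∑[ i < suc n ] count ℬ x (inj₂ i) ≡ count ℬ x x + n * 3
    within-row = ∑-except (count ℬ x ∘ inj₂) j
      (λ i i≢j → within x (inj₂ i) (i≢j ∘ sym ∘ inj₂-injective) tt)
    between-row : ∑[ i < suc m ] count ℬ x (inj₁ i) ≡ λ' * suc m
    between-row = trans (∑-count-across x inj₁ (λ _ ())) (*-comm (suc m) λ')

  ∑-replication₁ : 2 * ∑[ i < suc m ] count ℬ (inj₁ i) (inj₁ i) ≡ suc m * (m * 3 + λ' * suc n)
  ∑-replication₁ = trans (*-distribˡ-sum 2 (λ i → count ℬ (inj₁ i) (inj₁ i)))
                         (trans (sum-cong-≗ replication₁) (∑-const (suc m) (m * 3 + λ' * suc n)))

  ∑-replication₂ : 2 * ∑[ j < suc n ] count ℬ (inj₂ j) (inj₂ j) ≡ suc n * (n * 3 + λ' * suc m)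
  ∑-replication₂ = trans (*-distribˡ-sum 2 (λ j → count ℬ (inj₂ j) (inj₂ j)))
                         (trans (sum-cong-≗ replication₂) (∑-const (suc n) (n * 3 + λ' * suc m)))

  ordered-pair-identity :
    3 * (suc m * m + suc n * n) + 2 * (λ' * suc m * suc n) ≡ 6 * length ℬ
  ordered-pair-identity = begin
    3 * (suc m * m + suc n * n) + 2 * (λ' * suc m * suc n)
      ≡⟨ regroup m n λ' ⟩
    suc m * (m * 3 + λ' * suc n) + suc n * (n * 3 + λ' * suc m)
      ≡⟨ cong₂ _+_ ∑-replication₁ ∑-replication₂ ⟨
    2 * R₁ + 2 * R₂
      ≡⟨ *-distribˡ-+ 2 R₁ R₂ ⟨
    2 * ∑ᴾ (λ x → count ℬ x x)
      ≡⟨ cong (2 *_) (∑ᴾ-count-diagonal ℬ) ⟩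
    2 * (3 * length ℬ)
      ≡⟨ *-assoc 2 3 (length ℬ) ⟨
    6 * length ℬ ∎
    where
    open ≡-Reasoning
    R₁ R₂ : ℕ
    R₁ = ∑[ i < suc m ] count ℬ (inj₁ i) (inj₁ i)
    R₂ = ∑[ j < suc n ] count ℬ (inj₂ j) (inj₂ j)
    regroup : ∀ m n l → 3 * (suc m * m + suc n * n) + 2 * (l * suc m * suc n)
                      ≡ suc m * (m * 3 + l * suc n) + suc n * (n * 3 + l * suc m)
    regroup = solve-∀

  cross-pair-bound : λ' * suc m * suc n ≤ℕ 2 * length ℬ
  cross-pair-bound = begin
    λ' * suc m * suc n                                       ≡⟨ regroup λ' (suc m) (suc n) ⟩
    suc m * (suc n * λ')                                     ≡⟨ count-cross ⟨
    ∑[ i < suc m ] ∑[ j < suc n ] count ℬ (inj₁ i) (inj₂ j)  ≡⟨ ∑∑-count ℬ inj₁ inj₂ ⟩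
    ∑[ t < length ℬ ] (a t * b t)                            ≤⟨ ∑-mono-≤ a*b≤2 ⟩
    ∑[ t < length ℬ ] 2                                      ≡⟨ ∑-const (length ℬ) 2 ⟩
    length ℬ * 2                                             ≡⟨ *-comm (length ℬ) 2 ⟩
    2 * length ℬ                                             ∎
    where
    open ≤-Reasoning
    a b : Fin (length ℬ) → ℕ
    a t = ∑[ i < suc m ] inc (lookup ℬ t) (inj₁ i)
    b t = ∑[ j < suc n ] inc (lookup ℬ t) (inj₂ j)
    a*b≤2 : ∀ t → a t * b t ≤ℕ 2
    a*b≤2 t = m+n≡3⇒m*n≤2 {a t} {b t} (block-size (lookup ℬ t))
    count-cross : ∑[ i < suc m ] ∑[ j < suc n ] count ℬ (inj₁ i) (inj₂ j) ≡ suc m * (suc n * λ')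
    count-cross = trans (sum-cong-≗ (λ i → ∑-count-across (inj₁ i) inj₂ (λ _ ())))
                        (∑-const (suc m) (suc n * λ'))
    regroup : ∀ l M N → l * M * N ≡ M * (N * l)
    regroup = solve-∀

2*r≡a*3+b⇒2∣a+b : ∀ r a b → 2 * r ≡ a * 3 + b → 2 ∣ a + b
2*r≡a*3+b⇒2∣a+b r a b eq =
  ∣m+n∣m⇒∣n (subst (2 ∣_) (trans eq (split a b)) (m∣m*n r)) (m∣m*n a)
  where
  split : ∀ a b → a * 3 + b ≡ 2 * a + (a + b)
  split = solve-∀

3*x+2*c≡6*k⇒3∣c : ∀ x c k → 3 * x + 2 * c ≡ 6 * k → 3 ∣ c
3*x+2*c≡6*k⇒3∣c x c k eq = ∣m+n∣m⇒∣n (subst (3 ∣_) (+-comm c (2 * c)) (m∣m*n c)) 3∣2*c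
  where
  3∣2*c : 3 ∣ 2 * c
  3∣2*c = ∣m+n∣m⇒∣n (subst (3 ∣_) (trans (sym (*-assoc 3 2 k)) (sym eq)) (m∣m*n (2 * k)))
                    (m∣m*n x)

3*x+2*c≡6*k⇒c≤3*x : ∀ x c k → 3 * x + 2 * c ≡ 6 * k → c ≤ℕ 2 * k → c ≤ℕ 3 * x
3*x+2*c≡6*k⇒c≤3*x x c k eq c≤2k = +-cancelʳ-≤ (2 * c) c (3 * x) (begin
  c + 2 * c      ≡⟨⟩
  3 * c          ≤⟨ *-monoʳ-≤ 3 c≤2k ⟩
  3 * (2 * k)    ≡⟨ *-assoc 3 2 k ⟨
  6 * k          ≡⟨ eq ⟨
  3 * x + 2 * c  ∎)
  where open ≤-Reasoning

p/q≤a/c+b/d : ∀ p a b {q c d} → p * (suc c * suc d) ≤ℕ (a * suc d + b * suc c) * suc q →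
              (+ p) / suc q ≤ (+ a) / suc c +ℚ (+ b) / suc d
p/q≤a/c+b/d p a b {q} {c} {d} cross = toℚᵘ-cancel-≤ (begin
  toℚᵘ ((+ p) / suc q)
    ≃⟨ toℚᵘ-fromℚᵘ (mkℚᵘ (+ p) q) ⟩
  mkℚᵘ (+ p) q
    ≤⟨ *≤* (subst₂ ℤ._≤_ lhs rhs (ℤ.+≤+ cross)) ⟩
  mkℚᵘ (+ a) c ℚᵘ.+ mkℚᵘ (+ b) d
    ≃⟨ ℚᵘ.+-cong (toℚᵘ-fromℚᵘ (mkℚᵘ (+ a) c)) (toℚᵘ-fromℚᵘ (mkℚᵘ (+ b) d)) ⟨
  toℚᵘ ((+ a) / suc c) ℚᵘ.+ toℚᵘ ((+ b) / suc d)
    ≃⟨ toℚᵘ-homo-+ ((+ a) / suc c) ((+ b) / suc d) ⟨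
  toℚᵘ ((+ a) / suc c +ℚ (+ b) / suc d) ∎)
  where
  open ℚᵘ.≤-Reasoning
  lhs : + (p * (suc c * suc d)) ≡ + p ℤ.* + (suc c * suc d)
  lhs = ℤ.pos-* p (suc c * suc d)
  rhs : + ((a * suc d + b * suc c) * suc q) ≡ (+ a ℤ.* + suc d ℤ.+ + b ℤ.* + suc c) ℤ.* + suc q
  rhs = trans (ℤ.pos-* (a * suc d + b * suc c) (suc q))
              (cong (ℤ._* + suc q) (trans (ℤ.pos-+ (a * suc d) (b * suc c))
                                          (cong₂ ℤ._+_ (ℤ.pos-* a (suc d)) (ℤ.pos-* b (suc c)))))

theorem2 : (m n λ' : ℕ) → .{{_ : NonZero m}} → .{{_ : NonZero n}} → .{{_ : NonZero λ'}} →
    GDD m n 3 λ' →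
    (3 ∣ λ' * m * n)
    × ((2 ∣ (n ∸ 1) + λ' * m) × (2 ∣ (m ∸ 1) + λ' * n))
    × ((+ λ') / 3 ≤ ((+ (m ∸ 1)) / n) +ℚ ((+ (n ∸ 1)) / m))
theorem2 (suc m) (suc n) λ' (ℬ , gdd) =
    3*x+2*c≡6*k⇒3∣c X C K (ordered-pair-identity gdd)
  , ( 2*r≡a*3+b⇒2∣a+b (count ℬ (inj₂ zero) (inj₂ zero)) n (λ' * suc m) (replication₂ gdd zero)
    , 2*r≡a*3+b⇒2∣a+b (count ℬ (inj₁ zero) (inj₁ zero)) m (λ' * suc n) (replication₁ gdd zero) )
  , p/q≤a/c+b/d λ' m n (subst₂ _≤ℕ_ (reorder-pairs λ' (suc m) (suc n)) (reorder-sums m n)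
      (3*x+2*c≡6*k⇒c≤3*x X C K (ordered-pair-identity gdd) (cross-pair-bound gdd)))
  where
  X C K : ℕ
  X = suc m * m + suc n * n
  C = λ' * suc m * suc n
  K = length ℬ
  reorder-pairs : ∀ l M N → l * M * N ≡ l * (N * M)
  reorder-pairs = solve-∀
  reorder-sums : ∀ m n → 3 * (suc m * m + suc n * n) ≡ (m * suc m + n * suc n) * 3
  reorder-sums = solve-∀
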